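{- For all natural numbers $x,y$, writing $S_{9,0}([a,b))=S_{9,0}(b)-S_{9,0}(a)$, $$S_{9,0}([512x,512y))=3S_{9,0}([128x,128y))+3S_{9,0}([8x,8y))-9S_{9,0}([2x,2y)).$$
   Context: For an integer $n\ge 0$ with binary expansion $n=\sum_{k=0}^{v}a_k2^k$, $a_k\in\{0,1\}$, let $\sigma(n)=\sum_k a_k$ be its binary digit sum. For integers $m\ge 1$, $0\le l\le m-1$ and $x\in\mathbb{N}$, define $S_{m,l}(x)=\sum_{0\le n<x,\ n\equiv l \pmod m}(-1)^{\sigma(n)}$. -}

module Defs where

open import Data.Nat using (ℕ; zero; suc; _+_; _*_; _%_; _/_; _≡ᵇ_)
open import Data.Nat.DivMod
open import Data.Integer as ℤ using (ℤ; +_; -_)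
open import Data.Bool using (if_then_else_)

-- binary digit sum, computed with fuel (fuel n ≥ number of binary digits of n)
σ-fuel : ℕ → ℕ → ℕ
σ-fuel zero    n = 0
σ-fuel (suc f) n = n % 2 + σ-fuel f (n / 2)

σ : ℕ → ℕ
σ n = σ-fuel n n

sgn : ℕ → ℤ
sgn k = if k % 2 ≡ᵇ 0 then + 1 else - (+ 1)

S : (m l : ℕ) → .{{_ : Data.Nat.NonZero m}} → ℕ → ℤ
S m l zero    = + 0
S m l (suc x) = S m l x ℤ.+ (if x % m ≡ᵇ l % m then sgn (σ x) else + 0)

Sint : (m l : ℕ) → .{{_ : Data.Nat.NonZero m}} → ℕ → ℕ → ℤ
Sint m l a b = S m l b ℤ.- S m l a

{-# OPTIONS --safe #-}
-- Splitting [0, 2^k (x+1)) into blocks of length 2^k, the block starting at 2^k x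
-- contributes (-1)^σ(x) W_k(x), where W_k(x) depends only on x mod m because
-- (-1)^σ(2y) = (-1)^σ(y) and (-1)^σ(2y+1) = -(-1)^σ(y).  For m = 9, l = 0 the
-- nine residues satisfy W_9 = 3 W_7 + 3 W_3 - 9 W_1, which, summed over the blocks,
-- is the identity for S_{9,0}(2^9 x), ..., S_{9,0}(2 x); subtracting at x and y gives
-- the theorem.
module Submission where

open import Defs
open import Data.Nat using (ℕ; _*_)
open import Data.Integer using (ℤ; +_; _+_; _-_; -_) renaming (_*_ to _*ℤ_)
open import Relation.Binary.PropositionalEquality using (_≡_)

open import Data.Bool using (true; false; if_then_else_)
open import Data.Nat as ℕ using (zero; suc; _%_; _/_; _^_; _≤_; _<_; _≡ᵇ_; NonZero; s≤s; z≤n)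
open import Data.Nat.DivMod
open import Data.Nat.Properties using (≤-pred; ≤-refl; ≤-trans; *-comm; *-assoc; *-suc; *-identityˡ; +-comm)
open import Data.Integer.Properties using (neg-involutive; *-identityʳ; *-zeroʳ)
open import Data.Integer.Tactic.RingSolver using (solve-∀)
open import Relation.Binary.PropositionalEquality using (refl; sym; trans; cong; cong₂; subst; module ≡-Reasoning)

σ-fuel-zero : ∀ f → σ-fuel f 0 ≡ 0
σ-fuel-zero zero    = refl
σ-fuel-zero (suc f) = σ-fuel-zero f

half≤pred : ∀ n → suc n / 2 ≤ n
half≤pred n = ≤-pred (m/n<m (suc n) 2 (s≤s (s≤s z≤n)))

σ-fuel-irrelevant : ∀ {f f′} n → n ≤ f → n ≤ f′ → σ-fuel f n ≡ σ-fuel f′ n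
σ-fuel-irrelevant {f} {f′} zero _ _ = trans (σ-fuel-zero f) (sym (σ-fuel-zero f′))
σ-fuel-irrelevant {suc f} {suc f′} (suc n) (s≤s n≤f) (s≤s n≤f′) =
  cong (suc n % 2 ℕ.+_) (σ-fuel-irrelevant (suc n / 2) (≤-trans (half≤pred n) n≤f) (≤-trans (half≤pred n) n≤f′))

σ-unfold : ∀ n → σ n ≡ n % 2 ℕ.+ σ (n / 2)
σ-unfold zero    = refl
σ-unfold (suc n) = cong (suc n % 2 ℕ.+_) (σ-fuel-irrelevant (suc n / 2) (half≤pred n) ≤-refl)

double%2 : ∀ n → 2 * n % 2 ≡ 0
double%2 n = trans (cong (_% 2) (*-comm 2 n)) (m*n%n≡0 n 2)

double/2 : ∀ n → 2 * n / 2 ≡ n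
double/2 n = trans (cong (_/ 2) (*-comm 2 n)) (m*n/n≡m n 2)

suc-double%2 : ∀ n → suc (2 * n) % 2 ≡ 1
suc-double%2 n = trans (cong (λ r → suc r % 2) (*-comm 2 n)) ([m+kn]%n≡m%n 1 n 2)

suc-double/2 : ∀ n → suc (2 * n) / 2 ≡ n
suc-double/2 n = trans (+-distrib-/ 1 (2 * n) remainders<2) (double/2 n)
  where
  remainders<2 : 1 % 2 ℕ.+ 2 * n % 2 < 2
  remainders<2 = subst (λ r → 1 ℕ.+ r < 2) (sym (double%2 n)) ≤-refl

σ-double : ∀ n → σ (2 * n) ≡ σ n
σ-double n = trans (σ-unfold (2 * n)) (cong₂ (λ r q → r ℕ.+ σ q) (double%2 n) (double/2 n))

σ-suc-double : ∀ n → σ (suc (2 * n)) ≡ suc (σ n)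
σ-suc-double n = trans (σ-unfold (suc (2 * n))) (cong₂ (λ r q → r ℕ.+ σ q) (suc-double%2 n) (suc-double/2 n))

sgn-suc : ∀ k → sgn (suc k) ≡ - sgn k
sgn-suc zero    = refl
sgn-suc (suc k) = begin
  sgn (2 ℕ.+ k)     ≡⟨ cong (λ r → if r ≡ᵇ 0 then + 1 else - + 1) (trans (cong (_% 2) (+-comm 2 k)) ([m+n]%n≡m%n k 2)) ⟩
  sgn k             ≡⟨ sym (neg-involutive (sgn k)) ⟩
  - - sgn k         ≡⟨ cong -_ (sym (sgn-suc k)) ⟩
  - sgn (suc k)     ∎
  where open ≡-Reasoning

thueMorse : ℕ → ℤ
thueMorse n = sgn (σ n)

thueMorse-double : ∀ n → thueMorse (2 * n) ≡ thueMorse n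
thueMorse-double n = cong sgn (σ-double n)

thueMorse-suc-double : ∀ n → thueMorse (suc (2 * n)) ≡ - thueMorse n
thueMorse-suc-double n = trans (cong sgn (σ-suc-double n)) (sgn-suc (σ n))

%-cong-+ˡ : ∀ a {x y m} .{{_ : NonZero m}} → x % m ≡ y % m → (a ℕ.+ x) % m ≡ (a ℕ.+ y) % m
%-cong-+ˡ a {x} {y} {m} eq = begin
  (a ℕ.+ x) % m             ≡⟨ %-distribˡ-+ a x m ⟩
  (a % m ℕ.+ x % m) % m     ≡⟨ cong (λ r → (a % m ℕ.+ r) % m) eq ⟩
  (a % m ℕ.+ y % m) % m     ≡⟨ sym (%-distribˡ-+ a y m) ⟩
  (a ℕ.+ y) % m             ∎
  where open ≡-Reasoning

%-cong-*ˡ : ∀ a {x y m} .{{_ : NonZero m}} → x % m ≡ y % m → (a * x) % m ≡ (a * y) % m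
%-cong-*ˡ a {x} {y} {m} eq = begin
  (a * x) % m               ≡⟨ %-distribˡ-* a x m ⟩
  (a % m * (x % m)) % m     ≡⟨ cong (λ r → (a % m * r) % m) eq ⟩
  (a % m * (y % m)) % m     ≡⟨ sym (%-distribˡ-* a y m) ⟩
  (a * y) % m               ∎
  where open ≡-Reasoning

2^[1+k]*n≡2^k*[2*n] : ∀ k n → 2 ^ suc k * n ≡ 2 ^ k * (2 * n)
2^[1+k]*n≡2^k*[2*n] k n = begin
  2 * 2 ^ k * n     ≡⟨ cong (_* n) (*-comm 2 (2 ^ k)) ⟩
  2 ^ k * 2 * n     ≡⟨ *-assoc (2 ^ k) 2 n ⟩
  2 ^ k * (2 * n)   ∎
  where open ≡-Reasoning

module _ (m l : ℕ) .{{_ : NonZero m}} where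

  -- thueMorse x *ℤ blockWeight k x is the contribution to S m l of the block [2^k x, 2^k (x+1)).
  blockWeight : ℕ → ℕ → ℤ
  blockWeight zero    x = if x % m ≡ᵇ l % m then + 1 else + 0
  blockWeight (suc k) x = blockWeight k (2 * x) - blockWeight k (suc (2 * x))

  S-suc-block : ∀ k x →
    S m l (2 ^ k * suc x) ≡ S m l (2 ^ k * x) + thueMorse x *ℤ blockWeight k x
  S-suc-block zero x rewrite *-identityˡ x with x % m ≡ᵇ l % m
  ... | true  = cong (λ v → S m l x + v) (sym (*-identityʳ (thueMorse x)))
  ... | false = cong (λ v → S m l x + v) (sym (*-zeroʳ (thueMorse x)))
  S-suc-block (suc k) x = begin
    S m l (2 ^ suc k * suc x)
      ≡⟨ cong (S m l) (trans (2^[1+k]*n≡2^k*[2*n] k (suc x)) (cong (2 ^ k *_) (*-suc 2 x))) ⟩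
    S m l (2 ^ k * suc (suc (2 * x)))
      ≡⟨ S-suc-block k (suc (2 * x)) ⟩
    S m l (2 ^ k * suc (2 * x)) + thueMorse (suc (2 * x)) *ℤ w₁
      ≡⟨ cong₂ (λ a b → a + b *ℤ w₁) (S-suc-block k (2 * x)) (thueMorse-suc-double x) ⟩
    S m l (2 ^ k * (2 * x)) + thueMorse (2 * x) *ℤ w₀ + - thueMorse x *ℤ w₁
      ≡⟨ cong (λ t → S m l (2 ^ k * (2 * x)) + t *ℤ w₀ + - thueMorse x *ℤ w₁) (thueMorse-double x) ⟩
    S m l (2 ^ k * (2 * x)) + thueMorse x *ℤ w₀ + - thueMorse x *ℤ w₁
      ≡⟨ factor (S m l (2 ^ k * (2 * x))) (thueMorse x) w₀ w₁ ⟩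
    S m l (2 ^ k * (2 * x)) + thueMorse x *ℤ (w₀ - w₁)
      ≡⟨ cong (λ a → S m l a + thueMorse x *ℤ blockWeight (suc k) x) (sym (2^[1+k]*n≡2^k*[2*n] k x)) ⟩
    S m l (2 ^ suc k * x) + thueMorse x *ℤ blockWeight (suc k) x ∎
    where
    open ≡-Reasoning
    w₀ w₁ : ℤ
    w₀ = blockWeight k (2 * x)
    w₁ = blockWeight k (suc (2 * x))
    factor : ∀ a s u v → a + s *ℤ u + - s *ℤ v ≡ a + s *ℤ (u - v)
    factor = solve-∀

  blockWeight-cong-% : ∀ k {x y} → x % m ≡ y % m → blockWeight k x ≡ blockWeight k y
  blockWeight-cong-% zero    eq = cong (λ r → if r ≡ᵇ l % m then + 1 else + 0) eq
  blockWeight-cong-% (suc k) eq =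
    cong₂ _-_ (blockWeight-cong-% k (%-cong-*ˡ 2 eq)) (blockWeight-cong-% k (%-cong-+ˡ 1 (%-cong-*ˡ 2 eq)))

  blockWeight-% : ∀ k x → blockWeight k x ≡ blockWeight k (x % m)
  blockWeight-% k x = blockWeight-cong-% k (sym (m%n%n≡m%n x m))

W₉ : ℕ → ℕ → ℤ
W₉ = blockWeight 9 0

W₉-Relation : ℕ → Set
W₉-Relation x = W₉ 9 x ≡ ((+ 3 *ℤ W₉ 7 x) + (+ 3 *ℤ W₉ 3 x)) - (+ 9 *ℤ W₉ 1 x)

W₉-relation-residue : ∀ r → r < 9 → W₉-Relation r
W₉-relation-residue 0 _ = refl
W₉-relation-residue 1 _ = refl
W₉-relation-residue 2 _ = refl
W₉-relation-residue 3 _ = refl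
W₉-relation-residue 4 _ = refl
W₉-relation-residue 5 _ = refl
W₉-relation-residue 6 _ = refl
W₉-relation-residue 7 _ = refl
W₉-relation-residue 8 _ = refl
W₉-relation-residue (suc (suc (suc (suc (suc (suc (suc (suc (suc _))))))))) (s≤s (s≤s (s≤s (s≤s (s≤s (s≤s (s≤s (s≤s (s≤s ())))))))))

W₉-relation : ∀ x → W₉-Relation x
W₉-relation x = begin
  W₉ 9 x                                                              ≡⟨ W₉-% 9 ⟩
  W₉ 9 (x % 9)                                                        ≡⟨ W₉-relation-residue (x % 9) (m%n<n x 9) ⟩
  ((+ 3 *ℤ W₉ 7 (x % 9)) + (+ 3 *ℤ W₉ 3 (x % 9))) - (+ 9 *ℤ W₉ 1 (x % 9))
    ≡⟨ sym (cong₂ (λ a b → a - (+ 9 *ℤ b)) (cong₂ (λ a b → (+ 3 *ℤ a) + (+ 3 *ℤ b)) (W₉-% 7) (W₉-% 3)) (W₉-% 1)) ⟩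
  ((+ 3 *ℤ W₉ 7 x) + (+ 3 *ℤ W₉ 3 x)) - (+ 9 *ℤ W₉ 1 x)               ∎
  where
  open ≡-Reasoning
  W₉-% : ∀ k → W₉ k x ≡ W₉ k (x % 9)
  W₉-% k = blockWeight-% 9 0 k x

S₉ : ℕ → ℤ
S₉ = S 9 0

S₉-dilation : ∀ x → S₉ (512 * x) ≡ ((+ 3 *ℤ S₉ (128 * x)) + (+ 3 *ℤ S₉ (8 * x))) - (+ 9 *ℤ S₉ (2 * x))
S₉-dilation zero    = refl
S₉-dilation (suc x) = begin
  S₉ (512 * suc x)
    ≡⟨ block 9 ⟩
  S₉ (512 * x) + t *ℤ W₉ 9 x
    ≡⟨ cong₂ (λ a b → a + t *ℤ b) (S₉-dilation x) (W₉-relation x) ⟩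
  ((+ 3 *ℤ S₉ (128 * x)) + (+ 3 *ℤ S₉ (8 * x))) - (+ 9 *ℤ S₉ (2 * x))
    + t *ℤ (((+ 3 *ℤ W₉ 7 x) + (+ 3 *ℤ W₉ 3 x)) - (+ 9 *ℤ W₉ 1 x))
    ≡⟨ regroup (S₉ (128 * x)) (S₉ (8 * x)) (S₉ (2 * x)) t (W₉ 7 x) (W₉ 3 x) (W₉ 1 x) ⟩
  ((+ 3 *ℤ (S₉ (128 * x) + t *ℤ W₉ 7 x)) + (+ 3 *ℤ (S₉ (8 * x) + t *ℤ W₉ 3 x)))
    - (+ 9 *ℤ (S₉ (2 * x) + t *ℤ W₉ 1 x))
    ≡⟨ sym (cong₂ _-_ (cong₂ (λ a b → (+ 3 *ℤ a) + (+ 3 *ℤ b)) (block 7) (block 3)) (cong (+ 9 *ℤ_) (block 1))) ⟩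
  ((+ 3 *ℤ S₉ (128 * suc x)) + (+ 3 *ℤ S₉ (8 * suc x))) - (+ 9 *ℤ S₉ (2 * suc x)) ∎
  where
  open ≡-Reasoning
  t : ℤ
  t = thueMorse x
  block : ∀ k → S₉ (2 ^ k * suc x) ≡ S₉ (2 ^ k * x) + t *ℤ W₉ k x
  block k = S-suc-block 9 0 k x
  regroup : ∀ b c d s u v w →
    ((+ 3 *ℤ b) + (+ 3 *ℤ c)) - (+ 9 *ℤ d) + s *ℤ (((+ 3 *ℤ u) + (+ 3 *ℤ v)) - (+ 9 *ℤ w))
    ≡ ((+ 3 *ℤ (b + s *ℤ u)) + (+ 3 *ℤ (c + s *ℤ v))) - (+ 9 *ℤ (d + s *ℤ w))
  regroup = solve-∀

mainTheorem3 : (x y : ℕ) →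
    Sint 9 0 (512 * x) (512 * y)
      ≡ ((+ 3 *ℤ Sint 9 0 (128 * x) (128 * y))
          + (+ 3 *ℤ Sint 9 0 (8 * x) (8 * y)))
        - (+ 9 *ℤ Sint 9 0 (2 * x) (2 * y))
mainTheorem3 x y = trans (cong₂ _-_ (S₉-dilation y) (S₉-dilation x))
  (difference (S₉ (128 * x)) (S₉ (8 * x)) (S₉ (2 * x)) (S₉ (128 * y)) (S₉ (8 * y)) (S₉ (2 * y)))
  where
  difference : ∀ b c d b′ c′ d′ →
    (((+ 3 *ℤ b′) + (+ 3 *ℤ c′)) - (+ 9 *ℤ d′)) - (((+ 3 *ℤ b) + (+ 3 *ℤ c)) - (+ 9 *ℤ d))
    ≡ ((+ 3 *ℤ (b′ - b)) + (+ 3 *ℤ (c′ - c))) - (+ 9 *ℤ (d′ - d))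
  difference = solve-∀
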